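{- Let $\mathcal{G}$ be a $2$-$(n,b,k,r,\lambda)$ design. Then \[ \frac{n\lambda}{k}\leq e(\mathcal{G})\leq\frac{(n-1)\lambda}{k-1}. \] Moreover, if $\mathcal{G}$ is a symmetric design, then $e(\mathcal{G})=k=r$.
   Context: A $2$-$(n,b,k,r,\lambda)$ design is a $k$-uniform $r$-regular hypergraph (edges are $k$-element subsets of the vertex set) on $n$ vertices with $b$ edges such that every pair of distinct vertices is contained in exactly $\lambda$ edges. A symmetric design is a $2$-design with $n=b$. For a proper nonempty subset $S$ of the vertex set, with complement $\overline{S}$, $E(S,\overline{S})$ denotes the set of edges meeting both $S$ and $\overline{S}$; the edge connectivity $e(\mathcal{G})$ is the minimum of $|E(S,\overline{S})|$ over all proper nonempty $S$. -}

module Defs where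

open import Data.Nat using (ℕ; _≤_)
open import Data.Bool using (Bool; true; false; _∧_; _∨_)
open import Data.Vec using (Vec; []; _∷_; lookup; allFin; countᵇ)
open import Data.Fin using (Fin)
open import Data.Fin.Subset using (Subset; ∣_∣; ∁; Nonempty)
open import Data.Product using (Σ; _×_; ∃)
open import Relation.Binary.PropositionalEquality using (_≡_; _≢_)

-- A hypergraph on vertex set Fin n with b edges, given as an indexed
-- family of edges (repeated edges allowed, as usual for designs).
Hypergraph : ℕ → ℕ → Set
Hypergraph n b = Fin b → Subset n

meets : ∀ {n} → Subset n → Subset n → Bool
meets []      []      = false
meets (x ∷ A) (y ∷ B) = (x ∧ y) ∨ meets A B

countEdges : ∀ {n b} → Hypergraph n b → (Subset n → Bool) → ℕ
countEdges {b = b} G p = countᵇ (λ i → p (G i)) (allFin b)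

cutSize : ∀ {n b} → Hypergraph n b → Subset n → ℕ
cutSize G S = countEdges G (λ e → meets e S ∧ meets e (∁ S))

ProperNonempty : ∀ {n} → Subset n → Set
ProperNonempty S = Nonempty S × Nonempty (∁ S)

IsEdgeConnectivity : ∀ {n b} → Hypergraph n b → ℕ → Set
IsEdgeConnectivity {n} G e =
  (Σ (Subset n) λ S → ProperNonempty S × cutSize G S ≡ e) ×
  (∀ (S : Subset n) → ProperNonempty S → e ≤ cutSize G S)

record IsDesign {n b : ℕ} (G : Hypergraph n b) (k r λ' : ℕ) : Set where
  field
    uniform : ∀ (i : Fin b) → ∣ G i ∣ ≡ k
    regular : ∀ (v : Fin n) → countEdges G (λ e → lookup e v) ≡ r
    balanced : ∀ (v w : Fin n) → v ≢ w →
      countEdges G (λ e → lookup e v ∧ lookup e w) ≡ λ'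

-- Double counting incidences.  For a proper nonempty S pick u ∈ S and w ∉ S;
-- every vertex v has a partner (w if v ∈ S, u otherwise) and each of the λ
-- edges through v and its partner crosses S, so summing over v gives
-- nλ ≤ Σ_edges |edge| · [edge crosses S] = k · |E(S, S̄)|.  A singleton cut
-- has at most r edges and r(k − 1) = (n − 1)λ, which gives the upper bound.
-- For a symmetric design nr = bk forces r = k, so e ≤ k; and e ≤ k − 1 would
-- give nλ ≤ k(k − 1) = (n − 1)λ, impossible since λ > 0.
module Submission where

open import Defs
open import Data.Nat using (ℕ; _≤_; _*_; _∸_)
open import Data.Product using (_×_)
open import Relation.Binary.PropositionalEquality using (_≡_)

open import Data.Nat.Properties
open import Algebra.Properties.Semiring.Sum +-*-semiring
  using (sum-syntax; sum-cong-≗; ∑-comm; *-distribˡ-sum; *-distribʳ-sum)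
open import Data.Bool using (Bool; true; false; _∧_; _∨_; not)
open import Data.Bool.Properties using (∧-zeroʳ; ∧-identityʳ; ∨-identityʳ; ∨-zeroʳ; ¬-not)
open import Data.Empty using (⊥-elim)
open import Data.Fin using (Fin; zero; suc)
open import Data.Fin.Subset using (Subset; ∣_∣; ∁; ⁅_⁆; ⊥)
open import Data.Fin.Subset.Properties using (x∈∁p⇒x∉p)
open import Data.Nat using (zero; suc; _+_; z≤n; s≤s)
open import Data.Product using (_,_)
open import Data.Vec using ([]; _∷_; lookup; tabulate; countᵇ; here; there)
open import Data.Vec.Properties using (lookup-map; []=⇒lookup; lookup⇒[]=)
open import Relation.Binary.PropositionalEquality
  using (refl; sym; trans; cong; cong₂; _≢_; ≢-sym; module ≡-Reasoning)

𝟙 : Bool → ℕ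
𝟙 true  = 1
𝟙 false = 0

𝟙-∧ : ∀ a b → 𝟙 (a ∧ b) ≡ 𝟙 a * 𝟙 b
𝟙-∧ true  b = sym (+-identityʳ (𝟙 b))
𝟙-∧ false b = refl

𝟙-*-≤ : ∀ {a b c} → (a ≡ true → b ≡ true → c ≡ true) → 𝟙 a * 𝟙 b ≤ 𝟙 a * 𝟙 c
𝟙-*-≤ {true}  {true}  a∧b⇒c rewrite a∧b⇒c refl refl = ≤-refl
𝟙-*-≤ {true}  {false} _ = z≤n
𝟙-*-≤ {false}         _ = z≤n

𝟙-*-idem : ∀ a → 𝟙 a * 𝟙 a ≡ 𝟙 a
𝟙-*-idem true  = refl
𝟙-*-idem false = refl

𝟙-∧-≤ˡ : ∀ a b → 𝟙 (a ∧ b) ≤ 𝟙 a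
𝟙-∧-≤ˡ true  true  = ≤-refl
𝟙-∧-≤ˡ true  false = z≤n
𝟙-∧-≤ˡ false b     = z≤n

∑-mono-≤ : ∀ {n} {f g : Fin n → ℕ} → (∀ i → f i ≤ g i) → ∑[ i < n ] f i ≤ ∑[ i < n ] g i
∑-mono-≤ {zero}  f≤g = z≤n
∑-mono-≤ {suc n} f≤g = +-mono-≤ (f≤g zero) (∑-mono-≤ (λ i → f≤g (suc i)))

∑-const : ∀ n c → ∑[ i < n ] c ≡ n * c
∑-const zero    c = refl
∑-const (suc n) c = cong (c +_) (∑-const n c)

countᵇ-tabulate : ∀ {A : Set} n (p : A → Bool) (f : Fin n → A) →
  countᵇ p (tabulate f) ≡ ∑[ i < n ] 𝟙 (p (f i))
countᵇ-tabulate zero    p f = refl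
countᵇ-tabulate (suc n) p f with p (f zero)
... | true  = cong suc (countᵇ-tabulate n p (λ i → f (suc i)))
... | false = countᵇ-tabulate n p (λ i → f (suc i))

∣p∣≡∑ : ∀ {n} (p : Subset n) → ∣ p ∣ ≡ ∑[ v < n ] 𝟙 (lookup p v)
∣p∣≡∑ []          = refl
∣p∣≡∑ (true ∷ p)  = cong suc (∣p∣≡∑ p)
∣p∣≡∑ (false ∷ p) = ∣p∣≡∑ p

meets-intro : ∀ {n} (A B : Subset n) v →
  lookup A v ≡ true → lookup B v ≡ true → meets A B ≡ true
meets-intro (true ∷ A) (true ∷ B) zero    refl refl = refl
meets-intro (x ∷ A)    (y ∷ B)    (suc v) v∈A  v∈B
  rewrite meets-intro A B v v∈A v∈B = ∨-zeroʳ (x ∧ y)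

meets-⁅⁆ : ∀ {n} (e : Subset n) v → meets e ⁅ v ⁆ ≡ lookup e v
meets-⁅⁆ (x ∷ e) zero    = trans (cong₂ _∨_ (∧-identityʳ x) (meets-⊥ e)) (∨-identityʳ x)
  where
  meets-⊥ : ∀ {n} (e : Subset n) → meets e ⊥ ≡ false
  meets-⊥ []      = refl
  meets-⊥ (y ∷ e) = cong₂ _∨_ (∧-zeroʳ y) (meets-⊥ e)
meets-⁅⁆ (x ∷ e) (suc v) = trans (cong (_∨ meets e ⁅ v ⁆) (∧-zeroʳ x)) (meets-⁅⁆ e v)

crosses : ∀ {n} → Subset n → Subset n → Bool
crosses S e = meets e S ∧ meets e (∁ S)

crosses-intro : ∀ {n} (S e : Subset n) {v w} →
  lookup e v ≡ true → lookup e w ≡ true →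
  lookup S v ≡ true → lookup S w ≡ false → crosses S e ≡ true
crosses-intro S e {v} {w} v∈e w∈e v∈S w∉S
  rewrite meets-intro e S v v∈e v∈S
        | meets-intro e (∁ S) w w∈e (trans (lookup-map w not S) (cong not w∉S)) = refl

countEdges≡∑ : ∀ {n b} (G : Hypergraph n b) p → countEdges G p ≡ ∑[ i < b ] 𝟙 (p (G i))
countEdges≡∑ {b = b} G p = countᵇ-tabulate b (λ i → p (G i)) (λ i → i)

∑-incidence : ∀ {n b} (G : Hypergraph n b) (f : Fin b → ℕ) →
  ∑[ v < n ] ∑[ i < b ] (𝟙 (lookup (G i) v) * f i) ≡ ∑[ i < b ] (∣ G i ∣ * f i)
∑-incidence {n} {b} G f = begin
  ∑[ v < n ] ∑[ i < b ] (𝟙 (lookup (G i) v) * f i) ≡⟨ ∑-comm (λ v i → 𝟙 (lookup (G i) v) * f i) ⟩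
  ∑[ i < b ] ∑[ v < n ] (𝟙 (lookup (G i) v) * f i) ≡⟨ sum-cong-≗ column ⟩
  ∑[ i < b ] (∣ G i ∣ * f i) ∎
  where
  open ≡-Reasoning
  column : ∀ i → ∑[ v < n ] (𝟙 (lookup (G i) v) * f i) ≡ ∣ G i ∣ * f i
  column i = trans (sym (*-distribʳ-sum (f i) (λ v → 𝟙 (lookup (G i) v))))
                   (cong (_* f i) (sym (∣p∣≡∑ (G i))))

module _ {n b k r λ'} {G : Hypergraph n b} (D : IsDesign G k r λ') where
  open IsDesign D

  degree≡r : ∀ v → ∑[ i < b ] 𝟙 (lookup (G i) v) ≡ r
  degree≡r v = trans (sym (countEdges≡∑ G (λ e → lookup e v))) (regular v)

  codegree≡λ : ∀ {v w} → v ≢ w →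
    ∑[ i < b ] (𝟙 (lookup (G i) v) * 𝟙 (lookup (G i) w)) ≡ λ'
  codegree≡λ {v} {w} v≢w = begin
    ∑[ i < b ] (𝟙 (lookup (G i) v) * 𝟙 (lookup (G i) w))
      ≡⟨ sum-cong-≗ (λ i → sym (𝟙-∧ (lookup (G i) v) (lookup (G i) w))) ⟩
    ∑[ i < b ] 𝟙 (lookup (G i) v ∧ lookup (G i) w)
      ≡⟨ sym (countEdges≡∑ G (λ e → lookup e v ∧ lookup e w)) ⟩
    countEdges G (λ e → lookup e v ∧ lookup e w)
      ≡⟨ balanced v w v≢w ⟩
    λ' ∎
    where open ≡-Reasoning

  ∑-incidence-uniform : ∀ (f : Fin b → ℕ) →
    ∑[ v < n ] ∑[ i < b ] (𝟙 (lookup (G i) v) * f i) ≡ k * ∑[ i < b ] f i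
  ∑-incidence-uniform f = begin
    ∑[ v < n ] ∑[ i < b ] (𝟙 (lookup (G i) v) * f i) ≡⟨ ∑-incidence G f ⟩
    ∑[ i < b ] (∣ G i ∣ * f i)                       ≡⟨ sum-cong-≗ (λ i → cong (_* f i) (uniform i)) ⟩
    ∑[ i < b ] (k * f i)                             ≡⟨ sym (*-distribˡ-sum k f) ⟩
    k * ∑[ i < b ] f i                               ∎
    where open ≡-Reasoning

  n*r≡b*k : n * r ≡ b * k
  n*r≡b*k = begin
    n * r                                            ≡⟨ sym (∑-const n r) ⟩
    ∑[ v < n ] r                                     ≡⟨ sum-cong-≗ (λ v → sym (degree≡r v)) ⟩
    ∑[ v < n ] ∑[ i < b ] 𝟙 (lookup (G i) v)         ≡⟨ sum-cong-≗ {n} (λ v → sum-cong-≗ {b} (λ i → sym (*-identityʳ _))) ⟩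
    ∑[ v < n ] ∑[ i < b ] (𝟙 (lookup (G i) v) * 1)   ≡⟨ ∑-incidence-uniform (λ _ → 1) ⟩
    k * ∑[ i < b ] 1                                 ≡⟨ cong (k *_) (trans (∑-const b 1) (*-identityʳ b)) ⟩
    k * b                                            ≡⟨ *-comm k b ⟩
    b * k                                            ∎
    where open ≡-Reasoning

  λ≤edges-through : ∀ {v w} (c : Subset n → Bool) → v ≢ w →
    (∀ e → lookup e v ≡ true → lookup e w ≡ true → c e ≡ true) →
    λ' ≤ ∑[ i < b ] (𝟙 (lookup (G i) v) * 𝟙 (c (G i)))
  λ≤edges-through c v≢w vw⇒c = begin
    λ'                                                     ≡⟨ sym (codegree≡λ v≢w) ⟩
    ∑[ i < b ] (𝟙 (lookup (G i) _) * 𝟙 (lookup (G i) _))   ≤⟨ ∑-mono-≤ (λ i → 𝟙-*-≤ (vw⇒c (G i))) ⟩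
    ∑[ i < b ] (𝟙 (lookup (G i) _) * 𝟙 (c (G i)))          ∎
    where open ≤-Reasoning

  n*λ≤k*cutSize : ∀ S → ProperNonempty S → n * λ' ≤ k * cutSize G S
  n*λ≤k*cutSize S ((u , u∈S) , (w , w∈∁S)) = begin
    n * λ'                                                  ≡⟨ sym (∑-const n λ') ⟩
    ∑[ v < n ] λ'                                           ≤⟨ ∑-mono-≤ λ≤crossings-through ⟩
    ∑[ v < n ] ∑[ i < b ] (𝟙 (lookup (G i) v) * 𝟙 (crosses S (G i)))
                                                            ≡⟨ ∑-incidence-uniform (λ i → 𝟙 (crosses S (G i))) ⟩
    k * ∑[ i < b ] 𝟙 (crosses S (G i))                      ≡⟨ cong (k *_) (sym (countEdges≡∑ G (crosses S))) ⟩
    k * cutSize G S                                         ∎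
    where
    open ≤-Reasoning
    u∈Sᵇ : lookup S u ≡ true
    u∈Sᵇ = []=⇒lookup u∈S
    w∉Sᵇ : lookup S w ≡ false
    w∉Sᵇ = ¬-not (λ w∈S → x∈∁p⇒x∉p w∈∁S (lookup⇒[]= w S w∈S))
    separated : ∀ {x y} → lookup S x ≡ true → lookup S y ≡ false → x ≢ y
    separated x∈S y∉S refl with trans (sym x∈S) y∉S
    ... | ()
    λ≤crossings-through : ∀ v → λ' ≤ ∑[ i < b ] (𝟙 (lookup (G i) v) * 𝟙 (crosses S (G i)))
    λ≤crossings-through v with lookup S v in v∈S?
    ... | true  = λ≤edges-through (crosses S) (separated v∈S? w∉Sᵇ)
                    (λ e v∈e w∈e → crosses-intro S e v∈e w∈e v∈S? w∉Sᵇ)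
    ... | false = λ≤edges-through (crosses S) (≢-sym (separated u∈Sᵇ v∈S?))
                    (λ e v∈e u∈e → crosses-intro S e u∈e v∈e u∈Sᵇ v∈S?)

  cutSize-⁅⁆≤r : ∀ v → cutSize G ⁅ v ⁆ ≤ r
  cutSize-⁅⁆≤r v = begin
    cutSize G ⁅ v ⁆                         ≡⟨ countEdges≡∑ G (crosses ⁅ v ⁆) ⟩
    ∑[ i < b ] 𝟙 (crosses ⁅ v ⁆ (G i))      ≤⟨ ∑-mono-≤ (λ i → crossing⇒through (G i)) ⟩
    ∑[ i < b ] 𝟙 (lookup (G i) v)           ≡⟨ degree≡r v ⟩
    r                                       ∎
    where
    open ≤-Reasoning
    crossing⇒through : ∀ e → 𝟙 (crosses ⁅ v ⁆ e) ≤ 𝟙 (lookup e v)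
    crossing⇒through e = ≤-trans (𝟙-∧-≤ˡ (meets e ⁅ v ⁆) _) (≤-reflexive (cong 𝟙 (meets-⁅⁆ e v)))

module _ {m b k r λ'} {G : Hypergraph (suc m) b} (D : IsDesign G k r λ') where

  -- Count the pairs (w, edge) with both zero and w in the edge in two ways.
  r*k≡r+m*λ : r * k ≡ r + m * λ'
  r*k≡r+m*λ = begin
    r * k                                                     ≡⟨ *-comm r k ⟩
    k * r                                                     ≡⟨ cong (k *_) (sym (degree≡r D zero)) ⟩
    k * ∑[ i < b ] 𝟙 (lookup (G i) zero)                      ≡⟨ sym (∑-incidence-uniform D (λ i → 𝟙 (lookup (G i) zero))) ⟩
    ∑[ w < suc m ] ∑[ i < b ] (𝟙 (lookup (G i) w) * 𝟙 (lookup (G i) zero))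
                                                              ≡⟨ cong₂ _+_ degree-at-zero codegrees ⟩
    r + ∑[ j < m ] λ'                                         ≡⟨ cong (r +_) (∑-const m λ') ⟩
    r + m * λ'                                                ∎
    where
    open ≡-Reasoning
    degree-at-zero : ∑[ i < b ] (𝟙 (lookup (G i) zero) * 𝟙 (lookup (G i) zero)) ≡ r
    degree-at-zero = trans (sum-cong-≗ (λ i → 𝟙-*-idem (lookup (G i) zero))) (degree≡r D zero)
    codegrees : ∑[ j < m ] ∑[ i < b ] (𝟙 (lookup (G i) (suc j)) * 𝟙 (lookup (G i) zero)) ≡ ∑[ j < m ] λ'
    codegrees = sum-cong-≗ {m} (λ j → codegree≡λ D (λ ()))

  r*[k∸1]≡m*λ : r * (k ∸ 1) ≡ m * λ'
  r*[k∸1]≡m*λ = begin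
    r * (k ∸ 1)        ≡⟨ *-distribˡ-∸ r k 1 ⟩
    r * k ∸ r * 1      ≡⟨ cong₂ _∸_ r*k≡r+m*λ (*-identityʳ r) ⟩
    r + m * λ' ∸ r     ≡⟨ m+n∸m≡n r (m * λ') ⟩
    m * λ'             ∎
    where open ≡-Reasoning

-- With k ≥ 2 the identity forces λ > 0, so k * (k ∸ 1) < (m + 1) * λ ≤ k * e.
k≤e : ∀ {m λ' k e} → 2 ≤ k → k * (k ∸ 1) ≡ m * λ' → suc m * λ' ≤ k * e → k ≤ e
k≤e {m} {zero}    (s≤s (s≤s z≤n)) k*[k∸1]≡m*λ _ = ⊥-elim (1+n≢0 (trans k*[k∸1]≡m*λ (*-zeroʳ m)))
k≤e {m} {suc λ''} {k} {e} (s≤s (s≤s z≤n)) k*[k∸1]≡m*λ n*λ≤k*e = *-cancelˡ-< k (k ∸ 1) e (begin-strict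
  k * (k ∸ 1)            ≡⟨ k*[k∸1]≡m*λ ⟩
  m * suc λ''            <⟨ m<n+m (m * suc λ'') (s≤s z≤n) ⟩
  suc λ'' + m * suc λ''  ≤⟨ n*λ≤k*e ⟩
  k * e                  ∎)
  where open ≤-Reasoning

theorem3p9 : ∀ {n b k r λ' : ℕ} (G : Hypergraph n b) →
    2 ≤ n → 2 ≤ k → IsDesign G k r λ' →
    ∀ (e : ℕ) → IsEdgeConnectivity G e →
      (n * λ' ≤ k * e × e * (k ∸ 1) ≤ (n ∸ 1) * λ') ×
      (n ≡ b → e ≡ k × k ≡ r)
theorem3p9 {suc (suc m)} {b} {k} {r} {λ'} G (s≤s (s≤s z≤n)) 2≤k D e ((S , S-proper , cut≡e) , e-min) =
  (lower , upper) , symmetric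
  where
  lower : suc (suc m) * λ' ≤ k * e
  lower = ≤-trans (n*λ≤k*cutSize D S S-proper) (≤-reflexive (cong (k *_) cut≡e))
  e≤r : e ≤ r
  e≤r = ≤-trans (e-min ⁅ zero ⁆ ((zero , here) , (suc zero , there here))) (cutSize-⁅⁆≤r D zero)
  upper : e * (k ∸ 1) ≤ suc m * λ'
  upper = ≤-trans (*-monoˡ-≤ (k ∸ 1) e≤r) (≤-reflexive (r*[k∸1]≡m*λ D))
  symmetric : suc (suc m) ≡ b → e ≡ k × k ≡ r
  symmetric refl = ≤-antisym (≤-trans e≤r (≤-reflexive r≡k)) (k≤e {suc m} {λ'} 2≤k k*[k∸1]≡m*λ lower) , sym r≡k
    where
    r≡k : r ≡ k
    r≡k = *-cancelˡ-≡ r k (suc (suc m)) (n*r≡b*k D)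
    k*[k∸1]≡m*λ : k * (k ∸ 1) ≡ suc m * λ'
    k*[k∸1]≡m*λ = trans (cong (_* (k ∸ 1)) (sym r≡k)) (r*[k∸1]≡m*λ D)
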